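{- Consider odd positive integers $m$ such that the quadruple $(m,S(m),S^2(m),S^3(m))$ has distinct coordinates and $m<S(m)<S^2(m)$ (i.e. the triple $(m,S(m),S^2(m))$ has permutation pattern $(1,2,3)$). For such quadruples the only possible permutation patterns are $(1,2,3,4)$, $(1,2,4,3)$, $(2,3,4,1)$, $(1,3,4,2)$, and their permutation densities are \[ d_4(1,2,3,4)=\tfrac18,\quad d_4(1,2,4,3)=\tfrac1{16},\quad d_4(2,3,4,1)=\tfrac1{16},\quad d_4(1,3,4,2)=0. \] Moreover, the permutation pattern $(1,3,4,2)$ never occurs for any quadruple $(m,S(m),S^2(m),S^3(m))$.
   Context: Let $\Omega$ be the set of odd positive integers. The Syracuse function $S:\Omega\to\Omega$ is defined by $S(m)=(3m+1)/2^e$, where $e$ is the largest integer with $2^e\mid 3m+1$. Let $\Sigma_n$ be the permutations of $\{1,\dots,n\}$. For an $n$-tuple $X=(x_1,\dots,x_n)$ of distinct reals with coordinates in increasing order $y_1<\dots<y_n$, the permutation pattern of $X$ is the unique $\sigma\in\Sigma_n$ with $x_i=y_{\sigma(i)}$, written $(\sigma(1),\dots,\sigma(n))$. For $\sigma\in\Sigma_n$, $\Gamma_\sigma(M)$ is the number of $m\in\Omega$, $m\le M$, such that $(m,S(m),\dots,S^{n-1}(m))$ has distinct coordinates and permutation pattern $\sigma$, and $d_n(\sigma)=\lim_{M\to\infty}\Gamma_\sigma(M)/(M/2)$. -}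

module Defs where

open import Data.Nat using (ℕ; zero; suc; _+_; _*_; _^_; _<_; _≤_; _≟_; _<?_)
open import Data.Nat.DivMod using (_/_; _%_)
open import Data.Fin using (Fin; toℕ)
open import Data.Fin.Properties using (all?) renaming (_≟_ to _≟ᶠ_)
open import Data.Vec using (Vec; lookup)
open import Data.List using (List; length; filter; upTo)
open import Data.Product using (_×_)
open import Function using (_∘_)
open import Relation.Nullary using (¬_; Dec)
open import Relation.Nullary.Decidable using (_×-dec_; _→-dec_; ¬?)
open import Relation.Binary.PropositionalEquality using (_≡_; _≢_)
open import Data.Integer using (+_)
open import Data.Rational as ℚ using (ℚ; 0ℚ; ∣_∣)

Odd : ℕ → Set
Odd m = m % 2 ≡ 1

-- odd part of n, dividing out factors of 2 (with fuel f; fuel n suffices for n ≥ 1)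
oddPartF : ℕ → ℕ → ℕ
oddPartF zero n = n
oddPartF (suc f) n with n % 2
... | zero  = oddPartF f (n / 2)
... | suc _ = n

oddPart : ℕ → ℕ
oddPart n = oddPartF n n

S : ℕ → ℕ
S m = oddPart (3 * m + 1)

iterS : ℕ → ℕ → ℕ
iterS zero m = m
iterS (suc k) m = S (iterS k m)

orbit : (n : ℕ) → ℕ → Fin n → ℕ
orbit n m i = iterS (toℕ i) m

Distinct : ∀ {n} → (Fin n → ℕ) → Set
Distinct {n} x = ∀ (i j : Fin n) → i ≢ j → x i ≢ x j

-- number of coordinates strictly smaller than x i (0-based position of x i
-- in the increasing rearrangement y_1 < ... < y_n)
rank : ∀ {n} → (Fin n → ℕ) → Fin n → ℕ
rank x i = length (filter (λ j → x j <? x i) (Data.List.allFin _))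
  where import Data.List

-- X has distinct coordinates and permutation pattern σ = (σ(1),...,σ(n))
-- (given as a vector of 1-based values): x_i = y_{σ(i)}, i.e. x_i is the
-- σ(i)-th smallest coordinate.
HasPattern : ∀ {n} → (Fin n → ℕ) → Vec ℕ n → Set
HasPattern x σ = Distinct x × (∀ i → suc (rank x i) ≡ lookup σ i)

distinct? : ∀ {n} (x : Fin n → ℕ) → Dec (Distinct x)
distinct? x = all? λ i → all? λ j → ¬? (i ≟ᶠ j) →-dec ¬? (x i ≟ x j)

hasPattern? : ∀ {n} (x : Fin n → ℕ) (σ : Vec ℕ n) → Dec (HasPattern x σ)
hasPattern? x σ = distinct? x ×-dec all? (λ i → suc (rank x i) ≟ lookup σ i)

Γ : ∀ {n} → Vec ℕ n → ℕ → ℕ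
Γ {n} σ M = length (filter (λ m → ((m % 2) ≟ 1) ×-dec hasPattern? (orbit n m) σ) (upTo (suc M)))

-- d_n(σ) = q, i.e. lim_{M→∞} Γ_σ(M)/(M/2) = q (M ranges over positive integers)
HasDensity : ∀ {n} → Vec ℕ n → ℚ → Set
HasDensity σ q =
  ∀ (ε : ℚ) → 0ℚ ℚ.< ε → Σ ℕ λ N → ∀ (k : ℕ) → N ≤ k →
    ∣ (+ (2 * Γ σ (suc k))) ℚ./ (suc k) ℚ.- q ∣ ℚ.< ε
  where open import Data.Product using (Σ)

-- An odd m with m < S m lies in 3 + 4ℕ, since S n ≤ n on 1 + 4ℕ; and S maps 3 + 8ℕ into
-- 1 + 4ℕ, so an ascent m < S m < S² m forces m ∈ 7 + 8ℕ. On each of 15 + 16ℕ, 7 + 32ℕ and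
-- 23 + 32ℕ the first Syracuse iterates are affine in the parameter (for S³ on 23 + 32ℕ an
-- affine upper bound suffices), and comparing these affine maps fixes the pattern of
-- (m, S m, S² m, S³ m) as 1234, 1243 and 2341 respectively. So each pattern occurs exactly on
-- a residue class mod 16 or 32, whose counts up to M are M/16 resp. M/32 up to a bounded
-- error, while 1342, which would also start with an ascent, never occurs.

module Submission where

open import Defs
open import Data.Nat using (ℕ; _<_)
open import Data.Vec using (_∷_; [])
open import Data.Product using (_×_)
open import Data.Sum using (_⊎_)
open import Data.Integer using (+_)
open import Data.Rational using (_/_; 0ℚ)
open import Relation.Nullary using (¬_)

open import Data.Nat
  using (zero; suc; _≡ᵇ_; _+_; _*_; _^_; _∸_; _≤_; _≤′_; ≤′-refl; ≤′-step; z≤n; s≤s; z<s; _<?_; _≟_; NonZero)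
open import Data.Nat.Properties
open import Data.Nat.DivMod using (_%_; m≡m%n+[m/n]*n; m%n<n; [m+n]%n≡m%n; [m+kn]%n≡m%n;
  m*n%n≡0; m*n/n≡m; m<n⇒m%n≡m; %-distribˡ-+; %-distribˡ-*)
import Data.Nat.DivMod as ℕ
open import Data.Nat.Tactic.RingSolver using (solve-∀)
open import Data.Fin using (Fin; zero; suc)
open import Data.Vec using (Vec; lookup)
open import Data.Vec.Relation.Binary.Pointwise.Extensional using (ext; Pointwise-≡⇒≡)
open import Data.List using (List; [_]; _++_; filter; length; upTo; allFin; cartesianProduct)
open import Data.List.Properties using (filter-≐; filter-++; filter-accept; filter-reject; filter-none; length-++; upTo-∷ʳ)
open import Data.List.Relation.Unary.All using (All; _∷_; []; universal) renaming (lookup to All-lookup)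
open import Data.List.Membership.Propositional.Properties using (∈-filter⁺; ∈-cartesianProduct⁺; ∈-allFin)
open import Data.List.Relation.Binary.Sublist.Propositional using (⊆-refl)
open import Data.List.Relation.Binary.Sublist.Heterogeneous.Properties using (length-mono-≤; ⊆-filter-Sublist)
open import Data.Product using (Σ; ∃-syntax; _,_; proj₁; proj₂)
open import Data.Bool using (true; false)
open import Data.Sum using (inj₁; inj₂)
import Data.Sum as Sum
open import Data.Empty using (⊥-elim)
open import Function using (_⇔_; mk⇔; Equivalence)
open import Relation.Nullary using (yes; no; contradiction)
open import Relation.Nullary.Decidable using (from-yes; _×-dec_)
open import Relation.Binary using (tri<; tri≈; tri>)
open import Relation.Unary using (Decidable)
open import Relation.Binary.PropositionalEquality hiding ([_])
open import Data.Integer as ℤ using (+[1+_]; -[1+_]; _⊖_)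
import Data.Integer.Properties as ℤ
open import Data.Rational as ℚ using (ℚ; mkℚ; toℚᵘ)
import Data.Rational.Properties as ℚ
open import Data.Rational.Unnormalised as ℚᵘ using (mkℚᵘ; *<*)
import Data.Rational.Unnormalised.Properties as ℚᵘ

Even : ℕ → Set
Even m = m % 2 ≡ 0

odd-affine : ∀ {b c} → Odd b → Even c → ∀ q → Odd (b + q * c)
odd-affine {b} {c} odd-b even-c q = begin
  (b + q * c) % 2                           ≡⟨ %-distribˡ-+ b (q * c) 2 ⟩
  (b % 2 + q * c % 2) % 2                   ≡⟨ cong (λ t → (b % 2 + t) % 2) (%-distribˡ-* q c 2) ⟩
  (b % 2 + (q % 2 * (c % 2)) % 2) % 2       ≡⟨ cong₂ (λ u v → (u + (q % 2 * v) % 2) % 2) odd-b even-c ⟩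
  (1 + (q % 2 * 0) % 2) % 2                 ≡⟨ cong (λ t → (1 + t % 2) % 2) (*-zeroʳ (q % 2)) ⟩
  1                                         ∎
  where open ≡-Reasoning

n<2^n : ∀ n → n < 2 ^ n
n<2^n zero    = z<s
n<2^n (suc n) = +-mono-≤ (m^n>0 2 n) (≤-trans (n<2^n n) (m≤m+n (2 ^ n) 0))

oddPartF-*2 : ∀ f n → oddPartF (suc f) (n * 2) ≡ oddPartF f n
oddPartF-*2 f n rewrite m*n%n≡0 n 2 ⦃ _ ⦄ | m*n/n≡m n 2 ⦃ _ ⦄ = refl

oddPartF-*2^ : ∀ {f} e n → e ≤ f → oddPartF f (n * 2 ^ e) ≡ oddPartF (f ∸ e) n
oddPartF-*2^ {f} zero n _ = cong (oddPartF f) (*-identityʳ n)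
oddPartF-*2^ {suc f} (suc e) n (s≤s e≤f) = begin
  oddPartF (suc f) (n * (2 * 2 ^ e))  ≡⟨ cong (oddPartF (suc f)) (*-reorder n (2 ^ e)) ⟩
  oddPartF (suc f) (n * 2 ^ e * 2)    ≡⟨ oddPartF-*2 f (n * 2 ^ e) ⟩
  oddPartF f (n * 2 ^ e)              ≡⟨ oddPartF-*2^ e n e≤f ⟩
  oddPartF (f ∸ e) n                  ∎
  where
  open ≡-Reasoning
  *-reorder : ∀ n x → n * (2 * x) ≡ n * x * 2
  *-reorder = solve-∀

oddPartF-odd : ∀ f {n} → Odd n → oddPartF f n ≡ n
oddPartF-odd zero    _     = refl
oddPartF-odd (suc f) odd-n rewrite odd-n = refl

oddPartF-≤ : ∀ f n → oddPartF f n ≤ n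
oddPartF-≤ zero    n = ≤-refl
oddPartF-≤ (suc f) n with n % 2
... | zero  = ≤-trans (oddPartF-≤ f (n ℕ./ 2)) (ℕ.m/n≤m n 2)
... | suc _ = ≤-refl

S-via-oddPartF : ∀ {n k e} → 3 * n + 1 ≡ k * 2 ^ e → S n ≡ oddPartF (k * 2 ^ e ∸ e) k
S-via-oddPartF {n} {zero}  eq = contradiction (m+n≡0⇒n≡0 (3 * n) eq) λ ()
S-via-oddPartF {n} {suc k} {e} eq = trans (cong oddPart eq) (oddPartF-*2^ e (suc k) e≤k2^e)
  where
  e≤k2^e : e ≤ suc k * 2 ^ e
  e≤k2^e = ≤-trans (<⇒≤ (n<2^n e)) (m≤m+n (2 ^ e) (k * 2 ^ e))

S-≡ : ∀ {n k e} → 3 * n + 1 ≡ k * 2 ^ e → Odd k → S n ≡ k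
S-≡ {n} {k} {e} eq odd-k = trans (S-via-oddPartF {n} {k} {e} eq) (oddPartF-odd (k * 2 ^ e ∸ e) odd-k)

S-≤ : ∀ {n k e} → 3 * n + 1 ≡ k * 2 ^ e → S n ≤ k
S-≤ {n} {k} {e} eq = subst (_≤ k) (sym (S-via-oddPartF {n} {k} {e} eq)) (oddPartF-≤ (k * 2 ^ e ∸ e) k)

-- One exponent e serves the whole progression a + ℕ d once it works for a and for the step d.

3n+1-affine : ∀ a d b c e → 3 * a + 1 ≡ b * 2 ^ e → 3 * d ≡ c * 2 ^ e →
              ∀ q → 3 * (a + q * d) + 1 ≡ (b + q * c) * 2 ^ e
3n+1-affine a d b c e first step q = begin
  3 * (a + q * d) + 1          ≡⟨ expand a d q ⟩
  (3 * a + 1) + q * (3 * d)    ≡⟨ cong₂ (λ u v → u + q * v) first step ⟩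
  b * 2 ^ e + q * (c * 2 ^ e)  ≡⟨ collect b c q (2 ^ e) ⟩
  (b + q * c) * 2 ^ e          ∎
  where
  open ≡-Reasoning
  expand : ∀ a d q → 3 * (a + q * d) + 1 ≡ (3 * a + 1) + q * (3 * d)
  expand = solve-∀
  collect : ∀ b c q x → b * x + q * (c * x) ≡ (b + q * c) * x
  collect = solve-∀

S-affine : ∀ a d b c e → 3 * a + 1 ≡ b * 2 ^ e → 3 * d ≡ c * 2 ^ e → Odd b → Even c →
           ∀ q → S (a + q * d) ≡ b + q * c
S-affine a d b c e first step odd-b even-c q =
  S-≡ {a + q * d} {b + q * c} {e} (3n+1-affine a d b c e first step q) (odd-affine {b} {c} odd-b even-c q)

S-affine-≤ : ∀ a d b c e → 3 * a + 1 ≡ b * 2 ^ e → 3 * d ≡ c * 2 ^ e →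
             ∀ q → S (a + q * d) ≤ b + q * c
S-affine-≤ a d b c e first step q = S-≤ {a + q * d} {b + q * c} {e} (3n+1-affine a d b c e first step q)

affine-< : ∀ {a b d c} → a < b → d ≤ c → ∀ q → a + q * d < b + q * c
affine-< a<b d≤c q = +-mono-<-≤ a<b (*-monoʳ-≤ q d≤c)

affine-≤ : ∀ {a b d c} → a ≤ b → d ≤ c → ∀ q → a + q * d ≤ b + q * c
affine-≤ a≤b d≤c q = +-mono-≤ a≤b (*-monoʳ-≤ q d≤c)

InAP : ℕ → ℕ → ℕ → Set
InAP r d m = ∃[ q ] m ≡ r + q * d

%⇒InAP : ∀ {m r d} .{{_ : NonZero d}} → m % d ≡ r → InAP r d m
%⇒InAP {m} {d = d} m%d≡r = m ℕ./ d , trans (m≡m%n+[m/n]*n m d) (cong (_+ m ℕ./ d * d) m%d≡r)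

InAP⇒% : ∀ {m r d} .{{_ : NonZero d}} → r < d → InAP r d m → m % d ≡ r
InAP⇒% {r = r} {d} r<d (q , refl) = trans ([m+kn]%n≡m%n r q d) (m<n⇒m%n≡m r<d)

InAP-split : ∀ {m r d} → InAP r d m → InAP r (2 * d) m ⊎ InAP (r + d) (2 * d) m
InAP-split {r = r} {d} (q , m≡) with q % 2 | m≡m%n+[m/n]*n q 2 | m%n<n q 2
... | 0 | q≡ | _ = inj₁ (q ℕ./ 2 , trans m≡ (trans (cong (λ t → r + t * d) q≡) (even-half r d (q ℕ./ 2))))
  where
  even-half : ∀ r d h → r + (0 + h * 2) * d ≡ r + h * (2 * d)
  even-half = solve-∀
... | 1 | q≡ | _ = inj₂ (q ℕ./ 2 , trans m≡ (trans (cong (λ t → r + t * d) q≡) (odd-half r d (q ℕ./ 2))))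
  where
  odd-half : ∀ r d h → r + (1 + h * 2) * d ≡ r + d + h * (2 * d)
  odd-half = solve-∀
... | suc (suc _) | _ | s≤s (s≤s ())

S-1+4ℕ-≤ : ∀ {m} → InAP 1 4 m → S m ≤ m
S-1+4ℕ-≤ (q , refl) =
  ≤-trans (S-affine-≤ 1 4 1 3 2 refl refl q) (affine-≤ ≤-refl (≤ᵇ⇒≤ 3 4 _) q)

S-3+8ℕ : ∀ {m} → InAP 3 8 m → InAP 1 4 (S m)
S-3+8ℕ (q , refl) = 1 + q * 3 , trans (S-affine 3 8 5 12 1 refl refl refl refl q) (regroup q)
  where
  regroup : ∀ q → 5 + q * 12 ≡ 1 + (1 + q * 3) * 4
  regroup = solve-∀

ascent⇒InAP : ∀ {m} → Odd m → m < S m → S m < S (S m) →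
              InAP 15 16 m ⊎ InAP 7 32 m ⊎ InAP 23 32 m
ascent⇒InAP odd-m m<Sm Sm<S²m with InAP-split (%⇒InAP odd-m)
... | inj₁ m∈1+4ℕ = contradiction (S-1+4ℕ-≤ m∈1+4ℕ) (<⇒≱ m<Sm)
... | inj₂ m∈3+4ℕ with InAP-split m∈3+4ℕ
...   | inj₁ m∈3+8ℕ = contradiction (S-1+4ℕ-≤ (S-3+8ℕ m∈3+8ℕ)) (<⇒≱ Sm<S²m)
...   | inj₂ m∈7+8ℕ with InAP-split m∈7+8ℕ
...     | inj₂ m∈15+16ℕ = inj₁ m∈15+16ℕ
...     | inj₁ m∈7+16ℕ  = inj₂ (InAP-split m∈7+16ℕ)

rank-mono : ∀ {n} (x : Fin n → ℕ) {i j} → x i ≤ x j → rank x i ≤ rank x j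
rank-mono {n} x xi≤xj = length-mono-≤
  (⊆-filter-Sublist (λ k → x k <? _) (λ k → x k <? _) (λ { refl xk<xi → <-≤-trans xk<xi xi≤xj }) (⊆-refl {x = allFin n}))

HasPattern⇒< : ∀ {n} {x : Fin n → ℕ} {σ : Vec ℕ n} → HasPattern x σ →
               ∀ i j → lookup σ i < lookup σ j → x i < x j
HasPattern⇒< {x = x} {σ} (_ , ranks) i j σi<σj with x i <? x j
... | yes xi<xj = xi<xj
... | no  xi≮xj = contradiction σi<σj (≤⇒≯ (begin
  lookup σ j       ≡⟨ ranks j ⟨
  suc (rank x j)   ≤⟨ s≤s (rank-mono x (≮⇒≥ xi≮xj)) ⟩
  suc (rank x i)   ≡⟨ ranks i ⟩
  lookup σ i       ∎))
  where open ≤-Reasoning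

HasPattern-unique : ∀ {n} {x : Fin n → ℕ} {σ τ : Vec ℕ n} → HasPattern x σ → HasPattern x τ → σ ≡ τ
HasPattern-unique (_ , σ-ranks) (_ , τ-ranks) = Pointwise-≡⇒≡ (ext λ i → trans (sym (σ-ranks i)) (τ-ranks i))

module _ {n} {x y : Fin n → ℕ} (x-distinct : Distinct x) (x<⇒y< : ∀ i j → x i < x j → y i < y j) where

  y<⇒x< : ∀ i j → y i < y j → x i < x j
  y<⇒x< i j yi<yj with <-cmp (x i) (x j)
  ... | tri< xi<xj _ _ = xi<xj
  ... | tri≈ _ xi≡xj _ = ⊥-elim (x-distinct i j (λ { refl → <-irrefl refl yi<yj }) xi≡xj)
  ... | tri> _ _ xj<xi = ⊥-elim (<-asym yi<yj (x<⇒y< j i xj<xi))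

  Distinct-transport : Distinct y
  Distinct-transport i j i≢j yi≡yj with <-cmp (x i) (x j)
  ... | tri< xi<xj _ _ = <⇒≢ (x<⇒y< i j xi<xj) yi≡yj
  ... | tri≈ _ xi≡xj _ = x-distinct i j i≢j xi≡xj
  ... | tri> _ _ xj<xi = <⇒≢ (x<⇒y< j i xj<xi) (sym yi≡yj)

  rank-transport : ∀ i → rank y i ≡ rank x i
  rank-transport i = cong length
    (filter-≐ (λ j → y j <? y i) (λ j → x j <? x i) ((λ {j} → y<⇒x< j i) , (λ {j} → x<⇒y< j i)) (allFin n))

HasPattern-transport : ∀ {n} {x y : Fin n → ℕ} {σ : Vec ℕ n} → HasPattern x σ →
                       (∀ i j → x i < x j → y i < y j) → HasPattern y σ
HasPattern-transport (x-distinct , x-ranks) x<⇒y< =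
  Distinct-transport x-distinct x<⇒y< , λ i → trans (cong suc (rank-transport x-distinct x<⇒y< i)) (x-ranks i)

-- σ is its own pattern exactly when it is a permutation of 1, …, n.
IsPermutation : ∀ {n} → Vec ℕ n → Set
IsPermutation σ = HasPattern (lookup σ) σ

orderedPairs : ∀ {n} → Vec ℕ n → List (Fin n × Fin n)
orderedPairs σ = filter (λ (i , j) → lookup σ i <? lookup σ j) (cartesianProduct (allFin _) (allFin _))

HasPattern-from-pairs : ∀ {n} (σ : Vec ℕ n) {x : Fin n → ℕ} → IsPermutation σ →
                        All (λ (i , j) → x i < x j) (orderedPairs σ) → HasPattern x σ
HasPattern-from-pairs σ σ-perm increasing = HasPattern-transport {σ = σ} σ-perm λ i j σi<σj →
  All-lookup increasing (∈-filter⁺ (λ (i , j) → lookup σ i <? lookup σ j)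
                                   (∈-cartesianProduct⁺ (∈-allFin i) (∈-allFin j)) σi<σj)

σ₁₂₃₄ σ₁₂₄₃ σ₂₃₄₁ σ₁₃₄₂ : Vec ℕ 4
σ₁₂₃₄ = 1 ∷ 2 ∷ 3 ∷ 4 ∷ []
σ₁₂₄₃ = 1 ∷ 2 ∷ 4 ∷ 3 ∷ []
σ₂₃₄₁ = 2 ∷ 3 ∷ 4 ∷ 1 ∷ []
σ₁₃₄₂ = 1 ∷ 3 ∷ 4 ∷ 2 ∷ []

pattern-15+16ℕ : ∀ q → HasPattern (orbit 4 (15 + q * 16)) σ₁₂₃₄
pattern-15+16ℕ q = HasPattern-from-pairs σ₁₂₃₄ (from-yes (hasPattern? (lookup σ₁₂₃₄) σ₁₂₃₄))
  (x₀<x₁ ∷ <-trans x₀<x₁ x₁<x₂ ∷ <-trans x₀<x₁ (<-trans x₁<x₂ x₂<x₃) ∷ x₁<x₂ ∷ <-trans x₁<x₂ x₂<x₃ ∷ x₂<x₃ ∷ [])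
  where
  m : ℕ
  m = 15 + q * 16
  S¹ : S m ≡ 23 + q * 24
  S¹ = S-affine 15 16 23 24 1 refl refl refl refl q
  S² : S (S m) ≡ 35 + q * 36
  S² = trans (cong S S¹) (S-affine 23 24 35 36 1 refl refl refl refl q)
  S³ : S (S (S m)) ≡ 53 + q * 54
  S³ = trans (cong S S²) (S-affine 35 36 53 54 1 refl refl refl refl q)
  x₀<x₁ : m < S m
  x₀<x₁ = subst (m <_) (sym S¹) (affine-< (<ᵇ⇒< 15 23 _) (≤ᵇ⇒≤ 16 24 _) q)
  x₁<x₂ : S m < S (S m)
  x₁<x₂ = subst₂ _<_ (sym S¹) (sym S²) (affine-< (<ᵇ⇒< 23 35 _) (≤ᵇ⇒≤ 24 36 _) q)
  x₂<x₃ : S (S m) < S (S (S m))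
  x₂<x₃ = subst₂ _<_ (sym S²) (sym S³) (affine-< (<ᵇ⇒< 35 53 _) (≤ᵇ⇒≤ 36 54 _) q)

pattern-7+32ℕ : ∀ q → HasPattern (orbit 4 (7 + q * 32)) σ₁₂₄₃
pattern-7+32ℕ q = HasPattern-from-pairs σ₁₂₄₃ (from-yes (hasPattern? (lookup σ₁₂₄₃) σ₁₂₄₃))
  (x₀<x₁ ∷ <-trans x₀<x₁ (<-trans x₁<x₃ x₃<x₂) ∷ <-trans x₀<x₁ x₁<x₃ ∷ <-trans x₁<x₃ x₃<x₂ ∷ x₁<x₃ ∷ x₃<x₂ ∷ [])
  where
  m : ℕ
  m = 7 + q * 32
  S¹ : S m ≡ 11 + q * 48
  S¹ = S-affine 7 32 11 48 1 refl refl refl refl q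
  S² : S (S m) ≡ 17 + q * 72
  S² = trans (cong S S¹) (S-affine 11 48 17 72 1 refl refl refl refl q)
  S³ : S (S (S m)) ≡ 13 + q * 54
  S³ = trans (cong S S²) (S-affine 17 72 13 54 2 refl refl refl refl q)
  x₀<x₁ : m < S m
  x₀<x₁ = subst (m <_) (sym S¹) (affine-< (<ᵇ⇒< 7 11 _) (≤ᵇ⇒≤ 32 48 _) q)
  x₁<x₃ : S m < S (S (S m))
  x₁<x₃ = subst₂ _<_ (sym S¹) (sym S³) (affine-< (<ᵇ⇒< 11 13 _) (≤ᵇ⇒≤ 48 54 _) q)
  x₃<x₂ : S (S (S m)) < S (S m)
  x₃<x₂ = subst₂ _<_ (sym S³) (sym S²) (affine-< (<ᵇ⇒< 13 17 _) (≤ᵇ⇒≤ 54 72 _) q)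

-- Here S³ m depends on the 2-adic valuation of q, but the bound S³ m ≤ 20 + 27 q suffices.
pattern-23+32ℕ : ∀ q → HasPattern (orbit 4 (23 + q * 32)) σ₂₃₄₁
pattern-23+32ℕ q = HasPattern-from-pairs σ₂₃₄₁ (from-yes (hasPattern? (lookup σ₂₃₄₁) σ₂₃₄₁))
  (x₀<x₁ ∷ <-trans x₀<x₁ x₁<x₂ ∷ x₁<x₂ ∷ x₃<x₀ ∷ x₃<x₁ ∷ <-trans x₃<x₁ x₁<x₂ ∷ [])
  where
  m : ℕ
  m = 23 + q * 32
  S¹ : S m ≡ 35 + q * 48
  S¹ = S-affine 23 32 35 48 1 refl refl refl refl q
  S² : S (S m) ≡ 53 + q * 72
  S² = trans (cong S S¹) (S-affine 35 48 53 72 1 refl refl refl refl q)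
  S³ : S (S (S m)) ≤ 20 + q * 27
  S³ = subst (λ n → S n ≤ 20 + q * 27) (sym S²) (S-affine-≤ 53 72 20 27 3 refl refl q)
  x₀<x₁ : m < S m
  x₀<x₁ = subst (m <_) (sym S¹) (affine-< (<ᵇ⇒< 23 35 _) (≤ᵇ⇒≤ 32 48 _) q)
  x₁<x₂ : S m < S (S m)
  x₁<x₂ = subst₂ _<_ (sym S¹) (sym S²) (affine-< (<ᵇ⇒< 35 53 _) (≤ᵇ⇒≤ 48 72 _) q)
  x₃<x₀ : S (S (S m)) < m
  x₃<x₀ = ≤-<-trans S³ (affine-< (<ᵇ⇒< 20 23 _) (≤ᵇ⇒≤ 27 32 _) q)
  x₃<x₁ : S (S (S m)) < S m
  x₃<x₁ = <-trans x₃<x₀ x₀<x₁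

data AscentClass : Vec ℕ 4 → ℕ → ℕ → Set where
  class₁₂₃₄ : AscentClass σ₁₂₃₄ 15 16
  class₁₂₄₃ : AscentClass σ₁₂₄₃ 7 32
  class₂₃₄₁ : AscentClass σ₂₃₄₁ 23 32

Ascends : Vec ℕ 4 → Set
Ascends σ = lookup σ zero < lookup σ (suc zero) × lookup σ (suc zero) < lookup σ (suc (suc zero))

AscentClass-ascends : ∀ {σ r d} → AscentClass σ r d → Ascends σ
AscentClass-ascends class₁₂₃₄ = <ᵇ⇒< 1 2 _ , <ᵇ⇒< 2 3 _
AscentClass-ascends class₁₂₄₃ = <ᵇ⇒< 1 2 _ , <ᵇ⇒< 2 4 _
AscentClass-ascends class₂₃₄₁ = <ᵇ⇒< 2 3 _ , <ᵇ⇒< 3 4 _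

AscentClass-r<d : ∀ {σ r d} → AscentClass σ r d → r < d
AscentClass-r<d class₁₂₃₄ = <ᵇ⇒< 15 16 _
AscentClass-r<d class₁₂₄₃ = <ᵇ⇒< 7 32 _
AscentClass-r<d class₂₃₄₁ = <ᵇ⇒< 23 32 _

AscentClass-functional : ∀ {σ r d r′ d′} → AscentClass σ r d → AscentClass σ r′ d′ → r ≡ r′ × d ≡ d′
AscentClass-functional class₁₂₃₄ class₁₂₃₄ = refl , refl
AscentClass-functional class₁₂₄₃ class₁₂₄₃ = refl , refl
AscentClass-functional class₂₃₄₁ class₂₃₄₁ = refl , refl

AscentClass-pattern : ∀ {σ r d m} → AscentClass σ r d → InAP r d m → Odd m × HasPattern (orbit 4 m) σ
AscentClass-pattern class₁₂₃₄ (q , refl) = odd-affine {15} {16} refl refl q , pattern-15+16ℕ q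
AscentClass-pattern class₁₂₄₃ (q , refl) = odd-affine {7} {32} refl refl q , pattern-7+32ℕ q
AscentClass-pattern class₂₃₄₁ (q , refl) = odd-affine {23} {32} refl refl q , pattern-23+32ℕ q

ascent-classification : ∀ {m} → Odd m → m < S m → S m < S (S m) →
                        ∃[ σ ] ∃[ r ] ∃[ d ] AscentClass σ r d × InAP r d m
ascent-classification odd-m m<Sm Sm<S²m with ascent⇒InAP odd-m m<Sm Sm<S²m
... | inj₁ m∈         = σ₁₂₃₄ , 15 , 16 , class₁₂₃₄ , m∈
... | inj₂ (inj₁ m∈)  = σ₁₂₄₃ , 7 , 32 , class₁₂₄₃ , m∈
... | inj₂ (inj₂ m∈)  = σ₂₃₄₁ , 23 , 32 , class₂₃₄₁ , m∈

ascending-pattern-class : ∀ σ {m} → Odd m → HasPattern (orbit 4 m) σ → Ascends σ →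
                          ∃[ r ] ∃[ d ] AscentClass σ r d × InAP r d m
ascending-pattern-class σ odd-m has-σ (σ₀<σ₁ , σ₁<σ₂)
  with ascent-classification odd-m (HasPattern⇒< {σ = σ} has-σ zero (suc zero) σ₀<σ₁)
                                   (HasPattern⇒< {σ = σ} has-σ (suc zero) (suc (suc zero)) σ₁<σ₂)
... | σ′ , r , d , class , m∈ = r , d , subst (λ τ → AscentClass τ r d) (sym σ≡σ′) class , m∈
  where
  σ≡σ′ : σ ≡ σ′
  σ≡σ′ = HasPattern-unique {σ = σ} has-σ (proj₂ (AscentClass-pattern class m∈))

ascent-patterns : ∀ {m} → Odd m → m < S m → S m < S (S m) →
                  HasPattern (orbit 4 m) σ₁₂₃₄ ⊎ HasPattern (orbit 4 m) σ₁₂₄₃ ⊎ HasPattern (orbit 4 m) σ₂₃₄₁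
ascent-patterns odd-m m<Sm Sm<S²m with ascent-classification odd-m m<Sm Sm<S²m
... | _ , _ , _ , class₁₂₃₄ , m∈ = inj₁ (proj₂ (AscentClass-pattern class₁₂₃₄ m∈))
... | _ , _ , _ , class₁₂₄₃ , m∈ = inj₂ (inj₁ (proj₂ (AscentClass-pattern class₁₂₄₃ m∈)))
... | _ , _ , _ , class₂₃₄₁ , m∈ = inj₂ (inj₂ (proj₂ (AscentClass-pattern class₂₃₄₁ m∈)))

AscentClass-residue : ∀ {σ r d} .{{_ : NonZero d}} → AscentClass σ r d →
                      ∀ m → (Odd m × HasPattern (orbit 4 m) σ) ⇔ m % d ≡ r
AscentClass-residue {σ} {r} {d} class m = mk⇔ to (λ m%d≡r → AscentClass-pattern class (%⇒InAP m%d≡r))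
  where
  to : Odd m × HasPattern (orbit 4 m) σ → m % d ≡ r
  to (odd-m , has-σ) with ascending-pattern-class σ odd-m has-σ (AscentClass-ascends class)
  ... | _ , _ , class′ , m∈ with AscentClass-functional class class′
  ...   | refl , refl = InAP⇒% (AscentClass-r<d class) m∈

pattern₁₃₄₂-impossible : ∀ m → Odd m → ¬ HasPattern (orbit 4 m) σ₁₃₄₂
pattern₁₃₄₂-impossible m odd-m has-σ
  with ascending-pattern-class σ₁₃₄₂ odd-m has-σ (<ᵇ⇒< 1 3 _ , <ᵇ⇒< 3 4 _)
... | _ , _ , () , _

module ResidueCount (d r : ℕ) .{{d≢0 : NonZero d}} (r<d : r < d) where

  in-class? : Decidable (λ m → m % d ≡ r)
  in-class? m = m % d ≟ r

  hits : List ℕ → ℕ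
  hits ms = length (filter in-class? ms)

  count : ℕ → ℕ
  count N = hits (upTo N)

  count-suc : ∀ N → count (suc N) ≡ count N + hits [ N ]
  count-suc N = begin
    hits (upTo (suc N))                                           ≡⟨ cong hits (upTo-∷ʳ N) ⟨
    hits (upTo N ++ [ N ])                                        ≡⟨ cong length (filter-++ in-class? (upTo N) [ N ]) ⟩
    length (filter in-class? (upTo N) ++ filter in-class? [ N ])  ≡⟨ length-++ (filter in-class? (upTo N)) ⟩
    count N + hits [ N ]                                          ∎
    where open ≡-Reasoning

  hits-periodic : ∀ N → hits [ N + d ] ≡ hits [ N ]
  hits-periodic N rewrite [m+n]%n≡m%n N d ⦃ d≢0 ⦄ with N % d ≡ᵇ r
  ... | true  = refl
  ... | false = refl

  count-mono : ∀ {M N} → M ≤′ N → count M ≤ count N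
  count-mono ≤′-refl = ≤-refl
  count-mono (≤′-step {N} M≤′N) = ≤-trans (count-mono M≤′N) (≤-trans (m≤m+n (count N) _) (≤-reflexive (sym (count-suc N))))

  hits-r : hits [ r ] ≡ 1
  hits-r = cong length (filter-accept in-class? (m<n⇒m%n≡m r<d))

  hits-≢r : ∀ {s} → s < d → s ≢ r → hits [ s ] ≡ 0
  hits-≢r s<d s≢r = cong length (filter-reject in-class? (λ s%d≡r → s≢r (trans (sym (m<n⇒m%n≡m s<d)) s%d≡r)))

  count-≤r : ∀ s → s ≤ r → count s ≡ 0
  count-≤r zero    _   = refl
  count-≤r (suc s) s<r = trans (count-suc s) (cong₂ _+_ (count-≤r s (<⇒≤ s<r)) (hits-≢r (<-trans s<r r<d) (<⇒≢ s<r)))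

  count->r : ∀ t → t + suc r ≤ d → count (t + suc r) ≡ 1
  count->r zero    _       = trans (count-suc r) (cong₂ _+_ (count-≤r r ≤-refl) hits-r)
  count->r (suc t) t+1+r<d = trans (count-suc (t + suc r))
    (cong₂ _+_ (count->r t (<⇒≤ t+1+r<d)) (hits-≢r t+1+r<d (>⇒≢ (m≤n+m (suc r) t))))

  count-period : count d ≡ 1
  count-period = subst (λ N → count N ≡ 1) (m∸n+n≡m r<d) (count->r (d ∸ suc r) (≤-reflexive (m∸n+n≡m r<d)))

  count-+d : ∀ N → count (N + d) ≡ suc (count N)
  count-+d zero    = count-period
  count-+d (suc N) = begin
    count (suc (N + d))              ≡⟨ count-suc (N + d) ⟩
    count (N + d) + hits [ N + d ]   ≡⟨ cong₂ _+_ (count-+d N) (hits-periodic N) ⟩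
    suc (count N + hits [ N ])       ≡⟨ cong suc (count-suc N) ⟨
    suc (count (suc N))              ∎
    where open ≡-Reasoning

  count-*d+ : ∀ q s → count (q * d + s) ≡ q + count s
  count-*d+ zero    s = refl
  count-*d+ (suc q) s = begin
    count (d + q * d + s)       ≡⟨ cong count (trans (+-assoc d (q * d) s) (+-comm d (q * d + s))) ⟩
    count (q * d + s + d)       ≡⟨ count-+d (q * d + s) ⟩
    suc (count (q * d + s))     ≡⟨ cong suc (count-*d+ q s) ⟩
    suc q + count s             ∎
    where open ≡-Reasoning

  count-bounds : ∀ N → count N * d ≤ N + d × N ≤ count N * d + d
  count-bounds N = subst (λ M → count M * d ≤ M + d × M ≤ count M * d + d) N≡ (bounds (N ℕ./ d) (N % d) (m%n<n N d))
    where
    N≡ : N ℕ./ d * d + N % d ≡ N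
    N≡ = trans (+-comm (N ℕ./ d * d) (N % d)) (sym (m≡m%n+[m/n]*n N d))
    bounds : ∀ q s → s < d → count (q * d + s) * d ≤ q * d + s + d × q * d + s ≤ count (q * d + s) * d + d
    bounds q s s<d rewrite count-*d+ q s | *-distribʳ-+ d q (count s) =
        ≤-trans (+-monoʳ-≤ (q * d) (≤-trans (*-monoˡ-≤ d count-s≤1) (≤-trans (≤-reflexive (+-identityʳ d)) (m≤n+m d s))))
                (≤-reflexive (sym (+-assoc (q * d) s d)))
      , ≤-trans (+-monoʳ-≤ (q * d) (≤-trans (<⇒≤ s<d) (m≤n+m d (count s * d))))
                (≤-reflexive (sym (+-assoc (q * d) (count s * d) d)))
      where
      count-s≤1 : count s ≤ 1
      count-s≤1 = ≤-trans (count-mono (≤⇒≤′ (<⇒≤ s<d))) (≤-reflexive count-period)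

_⟶_ : (ℕ → ℚ) → ℚ → Set
u ⟶ ℓ = ∀ ε → 0ℚ ℚ.< ε → Σ ℕ λ N → ∀ k → N ≤ k → ℚ.∣ u k ℚ.- ℓ ∣ ℚ.< ε

∣⊖∣≤ : ∀ {x y B} → x ≤ y + B → y ≤ x + B → ℤ.∣ x ⊖ y ∣ ≤ B
∣⊖∣≤ {x} {y} x≤y+B y≤x+B with ≤-total x y
... | inj₁ x≤y rewrite ℤ.∣⊖∣-≤ x≤y = m≤n+o⇒m∸n≤o y x y≤x+B
... | inj₂ y≤x rewrite ℤ.∣m⊖n∣≡∣n⊖m∣ x y | ℤ.∣⊖∣-≤ y≤x = m≤n+o⇒m∸n≤o x y x≤y+B

toℚᵘ-distance : ∀ x k y q → toℚᵘ (ℚ.∣ + x ℚ./ suc k ℚ.- + y ℚ./ suc q ∣) ℚᵘ.≃ ℚᵘ.∣ mkℚᵘ (+ x) k ℚᵘ.- mkℚᵘ (+ y) q ∣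
toℚᵘ-distance x k y q =
  ℚᵘ.≃-trans (ℚ.toℚᵘ-homo-∣-∣ (u ℚ.- v))
    (ℚᵘ.∣-∣-cong (ℚᵘ.≃-trans (ℚ.toℚᵘ-homo-+ u (ℚ.- v))
      (ℚᵘ.+-cong (ℚ.toℚᵘ-fromℚᵘ (mkℚᵘ (+ x) k))
        (ℚᵘ.≃-trans (ℚ.toℚᵘ-homo‿- v) (ℚᵘ.-‿cong (ℚ.toℚᵘ-fromℚᵘ (mkℚᵘ (+ y) q)))))))
  where
  u v : ℚ
  u = + x ℚ./ suc k
  v = + y ℚ./ suc q

-- Cross-multiplying, ∣x/(k+1) - y/(q+1)∣ < (n+1)/(e+1) is an inequality between naturals.
distanceᵘ-< : ∀ x k y q n e → ℤ.∣ x * suc q ⊖ y * suc k ∣ * suc e < suc n * (suc k * suc q) →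
              ℚᵘ.∣ mkℚᵘ (+ x) k ℚᵘ.- mkℚᵘ (+ y) q ∣ ℚᵘ.< mkℚᵘ +[1+ n ] e
distanceᵘ-< x k y q n e lt =
  *<* (subst₂ ℤ._<_ (sym lhs) (sym (ℤ.pos-* (suc n) (suc k * suc q))) (ℤ.+<+ lt))
  where
  numerator : + x ℤ.* + suc q ℤ.+ ℤ.- (+ y) ℤ.* + suc k ≡ x * suc q ⊖ y * suc k
  numerator = trans (cong₂ ℤ._+_ (sym (ℤ.pos-* x (suc q)))
                       (trans (sym (ℤ.neg-distribˡ-* (+ y) (+ suc k))) (cong ℤ.-_ (sym (ℤ.pos-* y (suc k))))))
                    (ℤ.m-n≡m⊖n (x * suc q) (y * suc k))
  lhs : + ℤ.∣ + x ℤ.* + suc q ℤ.+ ℤ.- (+ y) ℤ.* + suc k ∣ ℤ.* + suc e ≡ + (ℤ.∣ x * suc q ⊖ y * suc k ∣ * suc e)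
  lhs = trans (cong (λ z → + ℤ.∣ z ∣ ℤ.* + suc e) numerator) (sym (ℤ.pos-* ℤ.∣ x * suc q ⊖ y * suc k ∣ (suc e)))

ratio-limit : ∀ (a : ℕ → ℕ) p q B → (∀ k → a k * suc q ≤ p * suc k + B) → (∀ k → p * suc k ≤ a k * suc q + B) →
              (λ k → + a k ℚ./ suc k) ⟶ (+ p ℚ./ suc q)
ratio-limit a p q B above below (mkℚ (+ 0) _ _) (ℚ.*<* (ℤ.+<+ ()))
ratio-limit a p q B above below (mkℚ -[1+ _ ] _ _) (ℚ.*<* ())
ratio-limit a p q B above below (mkℚ +[1+ n ] e _) _ = B * suc e , λ k B*e≤k →
  ℚ.toℚᵘ-cancel-< (ℚᵘ.<-respˡ-≃ (ℚᵘ.≃-sym (toℚᵘ-distance (a k) k p q))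
    (distanceᵘ-< (a k) k p q n e (begin-strict
      ℤ.∣ a k * suc q ⊖ p * suc k ∣ * suc e  ≤⟨ *-monoˡ-≤ (suc e) (∣⊖∣≤ (above k) (below k)) ⟩
      B * suc e                              ≤⟨ B*e≤k ⟩
      k                                      <⟨ n<1+n k ⟩
      suc k                                  ≤⟨ m≤m*n (suc k) (suc q) ⟩
      suc k * suc q                          ≤⟨ m≤n*m (suc k * suc q) (suc n) ⟩
      suc n * (suc k * suc q)                ∎)))
  where open ≤-Reasoning

-- Γ counts against M/2, the number of odd m ≤ M, hence the factor 2.
density-of-residue-class : ∀ {n} (σ : Vec ℕ n) {d r} .{{_ : NonZero d}} → r < d →
                           (∀ m → (Odd m × HasPattern (orbit n m) σ) ⇔ m % d ≡ r) → HasDensity σ (+ 2 ℚ./ d)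
density-of-residue-class {n} σ {suc d} {r} r<d residue =
  ratio-limit (λ k → 2 * Γ σ (suc k)) 2 d (2 * suc (suc d)) above below
  where
  open ResidueCount (suc d) r r<d
  Γ≡count : ∀ M → Γ σ M ≡ count (suc M)
  Γ≡count M = cong length (filter-≐ (λ m → (m % 2 ≟ 1) ×-dec hasPattern? (orbit n m) σ) in-class?
    ((λ {m} → Equivalence.to (residue m)) , (λ {m} → Equivalence.from (residue m))) (upTo (suc M)))
  above : ∀ k → 2 * Γ σ (suc k) * suc d ≤ 2 * suc k + 2 * suc (suc d)
  above k rewrite Γ≡count (suc k) = begin
    2 * count N * suc d          ≡⟨ *-assoc 2 (count N) (suc d) ⟩
    2 * (count N * suc d)        ≤⟨ *-monoʳ-≤ 2 (proj₁ (count-bounds N)) ⟩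
    2 * (N + suc d)              ≡⟨ regroup k d ⟩
    2 * suc k + 2 * suc (suc d)  ∎
    where
    open ≤-Reasoning
    N : ℕ
    N = suc (suc k)
    regroup : ∀ k d → 2 * (suc (suc k) + suc d) ≡ 2 * suc k + 2 * suc (suc d)
    regroup = solve-∀
  below : ∀ k → 2 * suc k ≤ 2 * Γ σ (suc k) * suc d + 2 * suc (suc d)
  below k rewrite Γ≡count (suc k) = begin
    2 * suc k                                   ≤⟨ *-monoʳ-≤ 2 (n≤1+n (suc k)) ⟩
    2 * N                                       ≤⟨ *-monoʳ-≤ 2 (proj₂ (count-bounds N)) ⟩
    2 * (count N * suc d + suc d)               ≤⟨ *-monoʳ-≤ 2 (+-monoʳ-≤ (count N * suc d) (n≤1+n (suc d))) ⟩
    2 * (count N * suc d + suc (suc d))         ≡⟨ regroup (count N) d ⟩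
    2 * count N * suc d + 2 * suc (suc d)       ∎
    where
    open ≤-Reasoning
    N : ℕ
    N = suc (suc k)
    regroup : ∀ c d → 2 * (c * suc d + suc (suc d)) ≡ 2 * c * suc d + 2 * suc (suc d)
    regroup = solve-∀

density-zero : ∀ {n} (σ : Vec ℕ n) → (∀ m → Odd m → ¬ HasPattern (orbit n m) σ) → HasDensity σ 0ℚ
density-zero {n} σ never = ratio-limit (λ k → 2 * Γ σ (suc k)) 0 0 0 above (λ _ → z≤n)
  where
  Γ≡0 : ∀ M → Γ σ M ≡ 0
  Γ≡0 M = cong length (filter-none (λ m → (m % 2 ≟ 1) ×-dec hasPattern? (orbit n m) σ)
    (universal (λ m (odd-m , has-σ) → never m odd-m has-σ) (upTo (suc M))))
  above : ∀ k → 2 * Γ σ (suc k) * 1 ≤ 0 * suc k + 0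
  above k rewrite Γ≡0 (suc k) = z≤n

mainTheorem11 : ((m : ℕ) → Odd m → Distinct (orbit 4 m) → m < S m → S m < S (S m) →
        HasPattern (orbit 4 m) (1 ∷ 2 ∷ 3 ∷ 4 ∷ [])
      ⊎ HasPattern (orbit 4 m) (1 ∷ 2 ∷ 4 ∷ 3 ∷ [])
      ⊎ HasPattern (orbit 4 m) (2 ∷ 3 ∷ 4 ∷ 1 ∷ [])
      ⊎ HasPattern (orbit 4 m) (1 ∷ 3 ∷ 4 ∷ 2 ∷ []))
    × HasDensity (1 ∷ 2 ∷ 3 ∷ 4 ∷ []) (+ 1 / 8)
    × HasDensity (1 ∷ 2 ∷ 4 ∷ 3 ∷ []) (+ 1 / 16)
    × HasDensity (2 ∷ 3 ∷ 4 ∷ 1 ∷ []) (+ 1 / 16)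
    × HasDensity (1 ∷ 3 ∷ 4 ∷ 2 ∷ []) 0ℚ
    × ((m : ℕ) → Odd m → ¬ HasPattern (orbit 4 m) (1 ∷ 3 ∷ 4 ∷ 2 ∷ []))
-- ℚ is normalised, so + 2 / 16 and + 1 / 8 agree definitionally.
mainTheorem11 =
    (λ m odd-m _ m<Sm Sm<S²m → Sum.map₂ (Sum.map₂ inj₁) (ascent-patterns odd-m m<Sm Sm<S²m))
  , density-of-residue-class σ₁₂₃₄ (AscentClass-r<d class₁₂₃₄) (AscentClass-residue class₁₂₃₄)
  , density-of-residue-class σ₁₂₄₃ (AscentClass-r<d class₁₂₄₃) (AscentClass-residue class₁₂₄₃)
  , density-of-residue-class σ₂₃₄₁ (AscentClass-r<d class₂₃₄₁) (AscentClass-residue class₂₃₄₁)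
  , density-zero σ₁₃₄₂ pattern₁₃₄₂-impossible
  , pattern₁₃₄₂-impossible
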